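{- $\mathbf{mCi}$ is not axiomatizable by a finite Set-Set H-system: there is no Set-Set H-system $\mathcal{H}$ with finitely many rule schemas such that, for all $\Gamma\cup\{\varphi\}\subseteq L$, $\Gamma\rhd_{\mathcal{H}}\{\varphi\}$ holds if and only if $\Gamma\vdash_{\mathbf{mCi}}\varphi$.
   Context: Let $\Sigma$ be the propositional signature with unary connectives $\neg,\circ$ and binary connectives $\land,\lor,\to$, and let $L$ be the set of $\Sigma$-formulas over a denumerable set $P$ of propositional variables. The logic $\mathbf{mCi}$ is the Tarskian consequence relation $\vdash_{\mathbf{mCi}}$ induced by the conventional (Set-Fmla) Hilbert system consisting of any Hilbert system for positive classical logic (the $\{\land,\lor,\to\}$-fragment of classical logic) extended with the axiom schemas $p\lor\neg p$; $\circ p\to(p\to(\neg p\to q))$; $\neg\circ p\to(p\land\neg p)$; and $\circ\neg^j\circ p$ for every $j\in\omega$ ($\neg^j$ being $j$-fold application of $\neg$). A Set-Set rule schema is a pair $(\Phi,\Psi)$ of finite sets of formulas, written $\Phi/\Psi$; its rule instances are all $(\sigma[\Phi],\sigma[\Psi])$ for substitutions $\sigma$. A Set-Set H-system $\mathcal{H}$ is a set of such rule schemas. An $\mathcal{H}$-derivation is a finite rooted tree whose nodes are labelled by sets of formulas or by a discontinuation symbol $*$, in which each non-leaf node with label $\Delta$ is expanded by some rule instance $\Phi/\Psi$ with $\Phi\subseteq\Delta$: if $\Psi\ne\varnothing$ the node has exactly one child for each $\psi\in\Psi$, labelled $\Delta\cup\{\psi\}$; if $\Psi=\varnothing$ it has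 a single child labelled $*$. An $\mathcal{H}$-proof of $(\Gamma,\Delta)$ is a derivation whose root label is contained in $\Gamma$ and each of whose leaves is labelled $*$ or by a set meeting $\Delta$. We write $\Gamma\rhd_{\mathcal{H}}\Delta$ iff there is an $\mathcal{H}$-proof of $(\Gamma,\Delta)$. -}

module Defs where

open import Level using (Level; 0ℓ; suc)
open import Data.Nat using (ℕ; zero; suc)
open import Data.List using (List; []; _∷_; map)
open import Data.List.Membership.Propositional using (_∈_)
open import Data.List.Relation.Unary.All using (All)
open import Data.Product using (Σ; ∃; _×_; _,_)
open import Relation.Binary.PropositionalEquality using (_≡_)
open import Relation.Unary using (Pred; _⊆_; _∪_; ｛_｝)

infixr 5 _⇒_
infixr 6 _∨'_
infixr 7 _∧'_

data Fm : Set where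
  var  : ℕ → Fm
  ¬'_  : Fm → Fm
  ∘_   : Fm → Fm
  _∧'_ : Fm → Fm → Fm
  _∨'_ : Fm → Fm → Fm
  _⇒_  : Fm → Fm → Fm

¬^ : ℕ → Fm → Fm
¬^ zero    φ = φ
¬^ (suc j) φ = ¬' (¬^ j φ)

Subst : Set
Subst = ℕ → Fm

sub : Subst → Fm → Fm
sub σ (var p)  = σ p
sub σ (¬' φ)   = ¬' sub σ φ
sub σ (∘ φ)    = ∘ sub σ φ
sub σ (φ ∧' ψ) = sub σ φ ∧' sub σ ψ
sub σ (φ ∨' ψ) = sub σ φ ∨' sub σ ψ
sub σ (φ ⇒ ψ)  = sub σ φ ⇒ sub σ ψ

data Axiom : Fm → Set where
  ax1 : ∀ a b → Axiom (a ⇒ (b ⇒ a))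
  ax2 : ∀ a b c → Axiom ((a ⇒ b) ⇒ ((a ⇒ (b ⇒ c)) ⇒ (a ⇒ c)))
  ax3 : ∀ a b → Axiom (a ⇒ (b ⇒ (a ∧' b)))
  ax4 : ∀ a b → Axiom ((a ∧' b) ⇒ a)
  ax5 : ∀ a b → Axiom ((a ∧' b) ⇒ b)
  ax6 : ∀ a b → Axiom (a ⇒ (a ∨' b))
  ax7 : ∀ a b → Axiom (b ⇒ (a ∨' b))
  ax8 : ∀ a b c → Axiom ((a ⇒ c) ⇒ ((b ⇒ c) ⇒ ((a ∨' b) ⇒ c)))
  ax9 : ∀ a b → Axiom (a ∨' (a ⇒ b))
  axEM   : ∀ a → Axiom (a ∨' (¬' a))
  axBc   : ∀ a b → Axiom (∘ a ⇒ (a ⇒ ((¬' a) ⇒ b)))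
  axCi   : ∀ a → Axiom ((¬' (∘ a)) ⇒ (a ∧' (¬' a)))
  axCc   : ∀ (j : ℕ) a → Axiom (∘ (¬^ j (∘ a)))

data _⊢mCi_ (Γ : Pred Fm 0ℓ) : Fm → Set where
  hyp : ∀ {φ} → Γ φ → Γ ⊢mCi φ
  ax  : ∀ {φ} → Axiom φ → Γ ⊢mCi φ
  mp  : ∀ {φ ψ} → Γ ⊢mCi φ → Γ ⊢mCi (φ ⇒ ψ) → Γ ⊢mCi ψ

record Rule : Set where
  constructor _/_
  field
    prem : List Fm
    conc : List Fm
open Rule public

FinHSystem : Set
FinHSystem = List Rule

-- A node labelled Λ is either a leaf whose label meets Δ,
-- or is expanded by a rule instance σ[Φ]/σ[Ψ] with σ[Φ] ⊆ Λ, with one child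
-- labelled Λ ∪ {σ(ψ)} for each ψ ∈ Ψ (when Ψ = ∅ the single child is the
-- discontinuation leaf *, which needs no further data).
data ProofTree (H : FinHSystem) (Δ : Pred Fm 0ℓ) : Pred Fm 0ℓ → Set₁ where
  leaf   : ∀ {Λ} φ → Λ φ → Δ φ → ProofTree H Δ Λ
  expand : ∀ {Λ} (r : Rule) → r ∈ H → (σ : Subst) →
           All Λ (map (sub σ) (prem r)) →
           (∀ ψ → ψ ∈ conc r → ProofTree H Δ (Λ ∪ ｛ sub σ ψ ｝)) →
           ProofTree H Δ Λ

_▷[_]_ : Pred Fm 0ℓ → FinHSystem → Pred Fm 0ℓ → Set₁
Γ ▷[ H ] Δ = Σ (Pred Fm 0ℓ) λ Λ → (Λ ⊆ Γ) × ProofTree H Δ Λ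

-- Let N bound the size of the formulas occurring in the rules of a finite H.
-- The collapse interpretation is Boolean except that ¬ φ is true whenever φ is
-- ¬ᵏ ∘ ψ with k ≥ N; as always ∘ φ is false exactly when φ and ¬ φ are both
-- true, so it falsifies the mCi theorem ∘ ¬ᴺ⁺¹ ∘ p.  Yet it respects every
-- instance σ of a rule Φ / Ψ of H: on formulas of size ≤ N, the collapse
-- interpretation after σ agrees with an mCi interpretation (negation classical on
-- formulas ¬ʲ ∘ ψ, elsewhere forced only by falsity), and soundness of H gives
-- Φ ⊢mCi ⋁ Ψ, which that interpretation respects.  So the collapse
-- interpretation validates everything H proves from ∅.
module Submission where

open import Defs
open import Level using (0ℓ)
open import Data.Bool using (Bool; true; false; not; _∧_; _∨_; if_then_else_; T)
open import Data.Bool.Properties using (T-≡; T-∧; ∨-zeroʳ; ∨-idem; ∧-inverseˡ)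
open import Data.Empty using (⊥-elim)
open import Data.List using (List; []; _∷_; map; _++_; concatMap)
open import Data.List.Extrema.Nat using (max; xs≤max)
open import Data.List.Membership.Propositional using (_∈_; find; lose)
open import Data.List.Relation.Unary.All as All using (All)
open import Data.List.Relation.Unary.All.Properties using (map⁺; map⁻; concat⁻; ++⁻ˡ; ++⁻ʳ)
open import Data.List.Relation.Unary.Any using (Any; here; there)
open import Data.Nat using (ℕ; zero; suc; _+_; _≤_; _<_; s≤s)
open import Data.Nat.Properties using (<⇒≤; m+n≤o⇒m≤o; m+n≤o⇒n≤o)
open import Data.Product using (Σ; ∃-syntax; _×_; _,_; proj₁; proj₂)
open import Data.Sum using (inj₁; inj₂)
open import Function using (id; Equivalence)
open import Relation.Binary.PropositionalEquality using (_≡_; refl; sym; trans; cong; cong₂; subst)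
open import Relation.Nullary using (¬_)
open import Relation.Unary using (Pred; ∅; ｛_｝; _∪_; _⊆_)

sub-var : ∀ φ → sub var φ ≡ φ
sub-var (var p)  = refl
sub-var (¬' φ)   = cong ¬'_ (sub-var φ)
sub-var (∘ φ)    = cong ∘_ (sub-var φ)
sub-var (φ ∧' ψ) = cong₂ _∧'_ (sub-var φ) (sub-var ψ)
sub-var (φ ∨' ψ) = cong₂ _∨'_ (sub-var φ) (sub-var ψ)
sub-var (φ ⇒ ψ)  = cong₂ _⇒_ (sub-var φ) (sub-var ψ)

size : Fm → ℕ
size (var _)  = 0
size (¬' φ)   = suc (size φ)
size (∘ φ)    = suc (size φ)
size (φ ∧' ψ) = suc (size φ + size ψ)
size (φ ∨' ψ) = suc (size φ + size ψ)
size (φ ⇒ ψ)  = suc (size φ + size ψ)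

circled : Fm → Bool
circled (¬' φ) = circled φ
circled (∘ φ)  = true
circled _      = false

deeplyCircled : ℕ → Fm → Bool
deeplyCircled zero    φ      = circled φ
deeplyCircled (suc k) (¬' φ) = deeplyCircled k φ
deeplyCircled (suc k) _      = false

circled-¬^∘ : ∀ j ψ → circled (¬^ j (∘ ψ)) ≡ true
circled-¬^∘ zero    ψ = refl
circled-¬^∘ (suc j) ψ = circled-¬^∘ j ψ

deeplyCircled-¬^∘ : ∀ k ψ → deeplyCircled k (¬^ k (∘ ψ)) ≡ true
deeplyCircled-¬^∘ zero    ψ = refl
deeplyCircled-¬^∘ (suc k) ψ = deeplyCircled-¬^∘ k ψ

deeplyCircled-¬ : ∀ k φ → deeplyCircled k φ ≡ true → deeplyCircled k (¬' φ) ≡ true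
deeplyCircled-¬ zero    φ      dc = dc
deeplyCircled-¬ (suc k) (¬' φ) dc = deeplyCircled-¬ k φ dc

deeplyCircled-sub-small : ∀ σ k φ → circled φ ≡ true → size φ ≤ k →
                          deeplyCircled k (sub σ φ) ≡ false
deeplyCircled-sub-small σ (suc k) (¬' φ) c (s≤s φ≤k) = deeplyCircled-sub-small σ k φ c φ≤k
deeplyCircled-sub-small σ (suc k) (∘ φ)  c _          = refl

-- Serves as ⋁ [], so it must be false in every interpretation.
falsum : Fm
falsum = ∘ var 0 ∧' (var 0 ∧' ¬' var 0)

⋁ : List Fm → Fm
⋁ []      = falsum
⋁ (ψ ∷ Ψ) = ψ ∨' ⋁ Ψ

⋁-intro : ∀ {Γ ψ Ψ} → ψ ∈ Ψ → Γ ⊢mCi ψ → Γ ⊢mCi ⋁ Ψ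
⋁-intro {ψ = ψ} {Ψ = _ ∷ Ψ} (here refl) ⊢ψ = mp ⊢ψ (ax (ax6 ψ (⋁ Ψ)))
⋁-intro {Ψ = χ ∷ Ψ}         (there ψ∈)  ⊢ψ = mp (⋁-intro ψ∈ ⊢ψ) (ax (ax7 χ (⋁ Ψ)))

-- Valuations where the value of ¬ φ may depend on the formula φ, not just on its value.
record Interpretation : Set where
  field
    atom : ℕ → Bool
    neg  : Fm → Bool → Bool
open Interpretation

eval : Interpretation → Fm → Bool
eval I (var p)  = atom I p
eval I (¬' φ)   = neg I φ (eval I φ)
eval I (∘ φ)    = not (eval I φ ∧ neg I φ (eval I φ))
eval I (φ ∧' ψ) = eval I φ ∧ eval I ψ
eval I (φ ∨' ψ) = eval I φ ∨ eval I ψ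
eval I (φ ⇒ ψ)  = not (eval I φ) ∨ eval I ψ

infix 4 _⊨_

_⊨_ : Interpretation → Fm → Set
I ⊨ φ = eval I φ ≡ true

⊭falsum : ∀ I → ¬ (I ⊨ falsum)
⊭falsum I ⊨falsum with trans (sym (∧-inverseˡ (eval I (var 0 ∧' ¬' var 0)))) ⊨falsum
... | ()

⋁-sound : ∀ I Ψ → I ⊨ ⋁ Ψ → Any (I ⊨_) Ψ
⋁-sound I []      ⊨falsum = ⊥-elim (⊭falsum I ⊨falsum)
⋁-sound I (ψ ∷ Ψ) ⊨⋁ with eval I ψ in ⊨ψ
... | true  = here ⊨ψ
... | false = there (⋁-sound I Ψ ⊨⋁)

module _ (I J : Interpretation) (σ : Subst) {N : ℕ}
         (atom-agree : ∀ p → atom I p ≡ eval J (σ p))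
         (neg-agree : ∀ φ → size φ < N →
                      neg I φ (eval J (sub σ φ)) ≡ neg J (sub σ φ) (eval J (sub σ φ)))
         where

  private
    ≤-left : ∀ m {n} → suc (m + n) ≤ N → m ≤ N
    ≤-left m le = m+n≤o⇒m≤o m (<⇒≤ le)

    ≤-right : ∀ m {n} → suc (m + n) ≤ N → n ≤ N
    ≤-right m le = m+n≤o⇒n≤o m (<⇒≤ le)

  eval-sub : ∀ φ → size φ ≤ N → eval I φ ≡ eval J (sub σ φ)
  eval-sub-¬ : ∀ φ → size φ < N → eval I (¬' φ) ≡ eval J (sub σ (¬' φ))

  eval-sub (var p)  _   = atom-agree p
  eval-sub (¬' φ)   φ<N = eval-sub-¬ φ φ<N
  eval-sub (∘ φ)    φ<N = cong₂ (λ a b → not (a ∧ b)) (eval-sub φ (<⇒≤ φ<N)) (eval-sub-¬ φ φ<N)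
  eval-sub (φ ∧' ψ) le  =
    cong₂ _∧_ (eval-sub φ (≤-left (size φ) le)) (eval-sub ψ (≤-right (size φ) le))
  eval-sub (φ ∨' ψ) le  =
    cong₂ _∨_ (eval-sub φ (≤-left (size φ) le)) (eval-sub ψ (≤-right (size φ) le))
  eval-sub (φ ⇒ ψ)  le  =
    cong₂ (λ a b → not a ∨ b) (eval-sub φ (≤-left (size φ) le)) (eval-sub ψ (≤-right (size φ) le))

  eval-sub-¬ φ φ<N = trans (cong (neg I φ) (eval-sub φ (<⇒≤ φ<N))) (neg-agree φ φ<N)

BoolFun : ℕ → Set
BoolFun zero    = Bool
BoolFun (suc n) = Bool → BoolFun n

truthTable : ∀ n → BoolFun n → Bool
truthTable zero    b = b
truthTable (suc n) f = truthTable n (f false) ∧ truthTable n (f true)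

Valid : ∀ n → BoolFun n → Set
Valid zero    b = b ≡ true
Valid (suc n) f = ∀ x → Valid n (f x)

tautology : ∀ n (f : BoolFun n) → T (truthTable n f) → Valid n f
tautology zero    b holds       = Equivalence.to T-≡ holds
tautology (suc n) f holds false = tautology n (f false) (proj₁ (Equivalence.to T-∧ holds))
tautology (suc n) f holds true  = tautology n (f true)  (proj₂ (Equivalence.to T-∧ holds))

modus-ponens : ∀ {x y} → x ≡ true → not x ∨ y ≡ true → y ≡ true
modus-ponens refl ⊨y = ⊨y

mCiInterpretation : (Fm → Bool) → Interpretation
mCiInterpretation choice = record
  { atom = λ p → choice (var p)
  ; neg  = λ φ b → if circled φ then not b else not b ∨ choice (¬' φ)
  }

module _ (choice : Fm → Bool) where

  private
    I : Interpretation
    I = mCiInterpretation choice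

    ⟦_⟧ : Fm → Bool
    ⟦_⟧ = eval I

  axiom-valid : ∀ {φ} → Axiom φ → I ⊨ φ
  axiom-valid (ax1 a b)   = tautology 2 (λ x y → not x ∨ (not y ∨ x)) _ ⟦ a ⟧ ⟦ b ⟧
  axiom-valid (ax2 a b c) =
    tautology 3 (λ x y z → not (not x ∨ y) ∨ (not (not x ∨ (not y ∨ z)) ∨ (not x ∨ z)))
              _ ⟦ a ⟧ ⟦ b ⟧ ⟦ c ⟧
  axiom-valid (ax3 a b)   = tautology 2 (λ x y → not x ∨ (not y ∨ (x ∧ y))) _ ⟦ a ⟧ ⟦ b ⟧
  axiom-valid (ax4 a b)   = tautology 2 (λ x y → not (x ∧ y) ∨ x) _ ⟦ a ⟧ ⟦ b ⟧
  axiom-valid (ax5 a b)   = tautology 2 (λ x y → not (x ∧ y) ∨ y) _ ⟦ a ⟧ ⟦ b ⟧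
  axiom-valid (ax6 a b)   = tautology 2 (λ x y → not x ∨ (x ∨ y)) _ ⟦ a ⟧ ⟦ b ⟧
  axiom-valid (ax7 a b)   = tautology 2 (λ x y → not y ∨ (x ∨ y)) _ ⟦ a ⟧ ⟦ b ⟧
  axiom-valid (ax8 a b c) =
    tautology 3 (λ x y z → not (not x ∨ z) ∨ (not (not y ∨ z) ∨ (not (x ∨ y) ∨ z)))
              _ ⟦ a ⟧ ⟦ b ⟧ ⟦ c ⟧
  axiom-valid (ax9 a b)   = tautology 2 (λ x y → x ∨ (not x ∨ y)) _ ⟦ a ⟧ ⟦ b ⟧
  axiom-valid (axEM a)    =
    tautology 3 (λ c x y → x ∨ (if c then not x else not x ∨ y)) _ (circled a) ⟦ a ⟧ (choice (¬' a))
  axiom-valid (axBc a b)  =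
    tautology 3 (λ x n y → not (not (x ∧ n)) ∨ (not x ∨ (not n ∨ y))) _ ⟦ a ⟧ (neg I a ⟦ a ⟧) ⟦ b ⟧
  axiom-valid (axCi a)    = tautology 1 (λ x → not (not (not x)) ∨ x) _ (⟦ a ⟧ ∧ neg I a ⟦ a ⟧)
  axiom-valid (axCc j a) rewrite circled-¬^∘ j a =
    tautology 1 (λ x → not (x ∧ not x)) _ ⟦ ¬^ j (∘ a) ⟧

  mCi-sound : ∀ {Γ φ} → Γ ⊆ (I ⊨_) → Γ ⊢mCi φ → I ⊨ φ
  mCi-sound ⊨Γ (hyp φ∈Γ) = ⊨Γ φ∈Γ
  mCi-sound ⊨Γ (ax axiom) = axiom-valid axiom
  mCi-sound ⊨Γ (mp ⊢φ ⊢φ⇒ψ) = modus-ponens (mCi-sound ⊨Γ ⊢φ) (mCi-sound ⊨Γ ⊢φ⇒ψ)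

collapse : ℕ → Interpretation
collapse N = record
  { atom = λ _ → true
  ; neg  = λ φ b → if deeplyCircled N φ then true else not b
  }

collapse-⊭∘¬^∘ : ∀ N ψ → ¬ (collapse N ⊨ ∘ ¬^ (suc N) (∘ ψ))
collapse-⊭∘¬^∘ N ψ
  rewrite deeplyCircled-¬^∘ N ψ | deeplyCircled-¬ N _ (deeplyCircled-¬^∘ N ψ) = λ ()

module _ (N : ℕ) (σ : Subst) where

  private
    C : Interpretation
    C = collapse N

    I : Interpretation
    I = mCiInterpretation (λ φ → eval C (sub σ φ))

  mCi-neg-agrees-collapse : ∀ φ → size φ < N →
    neg I φ (eval C (sub σ φ)) ≡ neg C (sub σ φ) (eval C (sub σ φ))
  mCi-neg-agrees-collapse φ φ<N with circled φ in φ-circled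
  ... | true rewrite deeplyCircled-sub-small σ N φ φ-circled (<⇒≤ φ<N) = refl
  ... | false with deeplyCircled N (sub σ φ)
  ...   | true  = ∨-zeroʳ (not (eval C (sub σ φ)))
  ...   | false = ∨-idem (not (eval C (sub σ φ)))

  mCi-agrees-collapse : ∀ φ → size φ ≤ N → eval I φ ≡ eval C (sub σ φ)
  mCi-agrees-collapse = eval-sub I C σ (λ _ → refl) mCi-neg-agrees-collapse

Respects : Interpretation → FinHSystem → Set
Respects I H = ∀ {r} → r ∈ H → ∀ σ →
  All (λ φ → I ⊨ sub σ φ) (prem r) → Any (λ ψ → I ⊨ sub σ ψ) (conc r)

ProofTree-weaken : ∀ {H Δ Λ Λ′} → Λ ⊆ Λ′ → ProofTree H Δ Λ → ProofTree H Δ Λ′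
ProofTree-weaken Λ⊆Λ′ (leaf φ φ∈Λ φ∈Δ) = leaf φ (Λ⊆Λ′ φ∈Λ) φ∈Δ
ProofTree-weaken Λ⊆Λ′ (expand r r∈H σ premises children) =
  expand r r∈H σ (All.map Λ⊆Λ′ premises) λ ψ ψ∈ →
    ProofTree-weaken (λ { (inj₁ φ∈Λ) → inj₁ (Λ⊆Λ′ φ∈Λ) ; (inj₂ eq) → inj₂ eq }) (children ψ ψ∈)

ProofTree-sound : ∀ {I H Δ Λ} → Respects I H → ProofTree H Δ Λ → Λ ⊆ (I ⊨_) →
                  ∃[ φ ] Δ φ × I ⊨ φ
ProofTree-sound respects (leaf φ φ∈Λ φ∈Δ) ⊨Λ = φ , φ∈Δ , ⊨Λ φ∈Λ
ProofTree-sound respects (expand r r∈H σ premises children) ⊨Λ =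
  let ψ , ψ∈ , ⊨ψ = find (respects r∈H σ (map⁻ (All.map ⊨Λ premises)))
  in ProofTree-sound respects (children ψ ψ∈) λ { (inj₁ φ∈Λ) → ⊨Λ φ∈Λ ; (inj₂ refl) → ⊨ψ }

Axiomatizes : FinHSystem → Set₁
Axiomatizes H = (Γ : Pred Fm 0ℓ) (φ : Fm) →
  (Γ ▷[ H ] ｛ φ ｝ → Γ ⊢mCi φ) × (Γ ⊢mCi φ → Γ ▷[ H ] ｛ φ ｝)

module _ {H : FinHSystem} (axiomatizes : Axiomatizes H) where

  ⊢mCi⇒ProofTree : ∀ {Γ φ} → Γ ⊢mCi φ → ProofTree H ｛ φ ｝ Γ
  ⊢mCi⇒ProofTree ⊢φ = let Λ , Λ⊆Γ , tree = proj₂ (axiomatizes _ _) ⊢φ in ProofTree-weaken Λ⊆Γ tree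

  rule-⊢mCi : ∀ {r} → r ∈ H → (_∈ prem r) ⊢mCi ⋁ (conc r)
  rule-⊢mCi {r} r∈H =
    proj₁ (axiomatizes Φ (⋁ (conc r))) (Φ , id , expand r r∈H var premises children)
    where
    Φ : Pred Fm 0ℓ
    Φ = _∈ prem r

    premises : All Φ (map (sub var) (prem r))
    premises = map⁺ (All.tabulate λ {φ} φ∈ → subst Φ (sym (sub-var φ)) φ∈)

    children : ∀ ψ → ψ ∈ conc r → ProofTree H ｛ ⋁ (conc r) ｝ (Φ ∪ ｛ sub var ψ ｝)
    children ψ ψ∈ = ⊢mCi⇒ProofTree (⋁-intro ψ∈ (hyp (inj₂ (sub-var ψ))))

ruleFormulas : Rule → List Fm
ruleFormulas r = prem r ++ conc r

maxSize : FinHSystem → ℕ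
maxSize H = max 0 (map size (concatMap ruleFormulas H))

ruleFormulas-≤-maxSize : ∀ {H r} → r ∈ H → All (λ φ → size φ ≤ maxSize H) (ruleFormulas r)
ruleFormulas-≤-maxSize {H} r∈H =
  All.lookup (map⁻ (concat⁻ (map⁻ (xs≤max 0 (map size (concatMap ruleFormulas H)))))) r∈H

collapse-respects : ∀ {H} → Axiomatizes H → Respects (collapse (maxSize H)) H
collapse-respects {H} axiomatizes {r} r∈H σ ⊨prem =
  let ψ , ψ∈ , ⊨ψ = find (⋁-sound I (conc r) (mCi-sound choice ⊨Φ (rule-⊢mCi axiomatizes r∈H)))
  in lose ψ∈ (trans (sym (agrees (All.lookup conc-bounded ψ∈))) ⊨ψ)
  where
  C : Interpretation
  C = collapse (maxSize H)

  choice : Fm → Bool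
  choice φ = eval C (sub σ φ)

  I : Interpretation
  I = mCiInterpretation choice

  agrees : ∀ {φ} → size φ ≤ maxSize H → eval I φ ≡ eval C (sub σ φ)
  agrees = mCi-agrees-collapse (maxSize H) σ _

  prem-bounded : All (λ φ → size φ ≤ maxSize H) (prem r)
  prem-bounded = ++⁻ˡ (prem r) (ruleFormulas-≤-maxSize r∈H)

  conc-bounded : All (λ φ → size φ ≤ maxSize H) (conc r)
  conc-bounded = ++⁻ʳ (prem r) (ruleFormulas-≤-maxSize r∈H)

  ⊨Φ : (_∈ prem r) ⊆ (I ⊨_)
  ⊨Φ φ∈ = trans (agrees (All.lookup prem-bounded φ∈)) (All.lookup ⊨prem φ∈)

theorem4 : ¬ (Σ FinHSystem λ H → (Γ : Pred Fm 0ℓ) (φ : Fm) →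
                 ((Γ ▷[ H ] ｛ φ ｝ → Γ ⊢mCi φ) × (Γ ⊢mCi φ → Γ ▷[ H ] ｛ φ ｝)))
theorem4 (H , axiomatizes) = collapse-⊭∘¬^∘ N (var 0) ⊨∘¬^∘
  where
  N : ℕ
  N = maxSize H

  derivation : ProofTree H ｛ ∘ ¬^ (suc N) (∘ var 0) ｝ ∅
  derivation = ⊢mCi⇒ProofTree axiomatizes (ax (axCc (suc N) (var 0)))

  ⊨∘¬^∘ : collapse N ⊨ ∘ ¬^ (suc N) (∘ var 0)
  ⊨∘¬^∘ with ProofTree-sound (collapse-respects axiomatizes) derivation (λ ())
  ... | _ , refl , ⊨φ = ⊨φ
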